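{- Let $G$ be a finite connected graph with at least one edge, $\Delta$ a decision tree for $G$ and $T$ a spanning tree of $G$. An edge $e\notin T$ is $\Delta$-active for $T$ if and only if $e$ is maximal for the $(\Delta,T)$-ordering in its fundamental cycle; an edge $e\in T$ is $\Delta$-active for $T$ if and only if $e$ is maximal for the $(\Delta,T)$-ordering in its fundamental cocycle.
   Context: Graphs are finite, loops and multiple edges allowed; $m=|E(G)|$. Subgraphs are spanning, identified with edge sets. An isthmus is an edge whose deletion increases the number of connected components; an edge is standard if neither a loop nor an isthmus. For a spanning tree $T$: the fundamental cycle of $e\notin T$ is the unique cycle contained in $T\cup\{e\}$; the fundamental cocycle of $e\in T$ is the set of edges of $G$ having one endpoint in each of the two components of $T\setminus e$. A decision tree for $G$ is a perfect binary tree with all leaves at depth $m-1$ (root at depth $0$), each node labelled by an edge of $G$, such that along every root-to-leaf path the labels form a permutation of $E(G)$. Given a subgraph $S$: set $H:=G$, $n:=$ root of $\Delta$; for $k=1,\dots,m$ let $e_k$ be the label of $n$ and do exactly one of: (i) if $e_k$ is standard in $H$ and $e_k\notin S$: type $\mathbf S_e$, $H:=H\setminus e_k$ (deletion), $n:=$ left child; (ii) if $e_k$ is a loop of $H$: type $\mathbf L$, $H:=H\setminus e_k$, $n:=$ left child; (iii) if $e_k$ is standard in $H$ and $e_k\in S$: type $\mathbf S_i$, $H:=H/e_k$ (contraction), $n:=$ right child; (iv) if $e_k$ is an isthmus of $H$: type $\mathbf I$, $H:=H/e_k$, $n:=$ right child. An edge is $\Delta$-active for $S$ if its type is $\mathbf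 L$ or $\mathbf I$. The $(\Delta,S)$-ordering is the total order $e_1<e_2<\dots<e_m$ of $E(G)$. -}

module Defs where

open import Data.Nat using (ℕ; zero; suc; _<_)
open import Data.Fin using (Fin)
import Data.Fin as Fin
open import Data.Bool using (Bool; true; false; _∧_; not; T)
open import Data.Unit using (tt)
open import Data.Product using (Σ; ∃; _×_; _,_; proj₁; proj₂; ∃-syntax)
open import Data.Sum using (_⊎_)
open import Data.List using (List; []; _∷_; _++_; map)
open import Data.List.Membership.Propositional using (_∈_)
open import Data.List.Relation.Unary.Unique.Propositional using (Unique)
open import Relation.Nullary using (¬_; Dec; yes; no)
open import Relation.Nullary.Decidable using (⌊_⌋)
open import Relation.Binary.Definitions using (DecidableEquality)
open import Relation.Binary.PropositionalEquality using (_≡_; refl; _≢_)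

-- A graph has a vertex type V (with decidable equality), an endpoint map
-- for every potential edge, and a Boolean mask E telling which of the
-- m potential edges are (still) edges of the graph.  Deletion and
-- contraction keep the edge names, so an edge of G keeps its identity
-- in every minor.  Loops (equal endpoints) and multiple edges allowed.

record Graph (m : ℕ) : Set₁ where
  field
    V    : Set
    decV : DecidableEquality V
    ends : Fin m → V × V
    E    : Fin m → Bool
open Graph public

mkGraph : ∀ {n m} → (Fin m → Fin n × Fin n) → Graph m
mkGraph {n} en = record { V = Fin n ; decV = Fin._≟_ ; ends = en ; E = λ _ → true }

restrict : ∀ {m} → Graph m → (Fin m → Bool) → Graph m
restrict H S = record H { E = λ i → E H i ∧ S i }

minus : ∀ {m} → (Fin m → Bool) → Fin m → (Fin m → Bool)
minus S e i = S i ∧ not ⌊ i Fin.≟ e ⌋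

plus : ∀ {m} → (Fin m → Bool) → Fin m → (Fin m → Bool)
plus S e i = Data.Bool._∨_ (S i) ⌊ i Fin.≟ e ⌋

delete : ∀ {m} → Graph m → Fin m → Graph m
delete H e = record H { E = minus (E H) e }

-- Contraction H / e for a non-loop e with ends (u , v): the vertex v is
-- removed (new vertex type = vertices different from v), every
-- occurrence of v is replaced by u, and e is removed.  (For a loop,
-- contraction is deletion; this case never occurs in the process.)
private
  Rest : ∀ {V : Set} → DecidableEquality V → V → Set
  Rest {V} d v = Σ V (λ x → T (not ⌊ d x v ⌋))

  T-unique : ∀ {b} (p q : T b) → p ≡ q
  T-unique {true} tt tt = refl

  decRest : ∀ {V : Set} (d : DecidableEquality V) (v : V) → DecidableEquality (Rest d v)
  decRest d v (x , p) (y , q) with d x y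
  ... | yes refl with T-unique p q
  ...   | refl = yes refl
  decRest d v (x , p) (y , q) | no x≢y = no λ { refl → x≢y refl }

  inRest : ∀ {V : Set} (d : DecidableEquality V) (v x : V) → ¬ x ≡ v → T (not ⌊ d x v ⌋)
  inRest d v x x≢v with d x v
  ... | yes x≡v = x≢v x≡v
  ... | no _ = tt

  merge : ∀ {V : Set} (d : DecidableEquality V) (u v : V) → ¬ u ≡ v → V → Rest d v
  merge d u v u≢v x with d x v
  ... | yes _ = u , inRest d v u u≢v
  ... | no x≢v = x , inRest d v x x≢v

  contract′ : ∀ {m} (H : Graph m) (e : Fin m) (u v : V H) → Dec (u ≡ v) → Graph m
  contract′ H e u v (yes _) = delete H e
  contract′ H e u v (no u≢v) = record
    { V = Rest (decV H) v
    ; decV = decRest (decV H) v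
    ; ends = λ i → merge (decV H) u v u≢v (proj₁ (ends H i))
                 , merge (decV H) u v u≢v (proj₂ (ends H i))
    ; E = minus (E H) e
    }

contract : ∀ {m} → Graph m → Fin m → Graph m
contract H e = contract′ H e u v (decV H u v)
  where
  u = proj₁ (ends H e)
  v = proj₂ (ends H e)

Link : ∀ {V : Set} → V × V → V → V → Set
Link (a , b) x y = (a ≡ x × b ≡ y) ⊎ (a ≡ y × b ≡ x)

-- Walk H x y es vs : a walk in H from x to y traversing the edges es
-- (in order); vs lists the vertex at which each edge is entered.
data Walk {m} (H : Graph m) : V H → V H → List (Fin m) → List (V H) → Set where
  nil  : ∀ {x} → Walk H x x [] []
  cons : ∀ {x y z es vs} (i : Fin m) → T (E H i) → Link (ends H i) x y →
         Walk H y z es vs → Walk H x z (i ∷ es) (x ∷ vs)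

Conn : ∀ {m} (H : Graph m) → V H → V H → Set
Conn H x y = ∃[ es ] ∃[ vs ] Walk H x y es vs

-- H has exactly k connected components: there is a surjective labelling
-- of the vertices by Fin k whose fibres are exactly the components.
NumComponents : ∀ {m} → Graph m → ℕ → Set
NumComponents H k =
  Σ (V H → Fin k) λ c →
    (∀ x y → (c x ≡ c y → Conn H x y) × (Conn H x y → c x ≡ c y)) ×
    (∀ j → ∃[ x ] c x ≡ j)

Cycle : ∀ {m} (H : Graph m) → V H → List (Fin m) → List (V H) → Set
Cycle H x es vs = Walk H x x es vs × ¬ (es ≡ []) × Unique es × Unique vs

IsLoop : ∀ {m} → Graph m → Fin m → Set
IsLoop H e = T (E H e) × proj₁ (ends H e) ≡ proj₂ (ends H e)

IsIsthmus : ∀ {m} → Graph m → Fin m → Set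
IsIsthmus H e = T (E H e) ×
  ∃[ k ] ∃[ k′ ] (NumComponents H k × NumComponents (delete H e) k′ × k < k′)

IsStandard : ∀ {m} → Graph m → Fin m → Set
IsStandard H e = T (E H e) × ¬ IsLoop H e × ¬ IsIsthmus H e

Connected : ∀ {m} → Graph m → Set
Connected H = ∀ x y → Conn H x y

IsSpanningTree : ∀ {m} → Graph m → (Fin m → Bool) → Set
IsSpanningTree G S = Connected (restrict G S) ×
  (∀ x es vs → ¬ Cycle (restrict G S) x es vs)

-- Tree m: perfect binary tree whose internal nodes are
-- labelled by edges; the labelled nodes are exactly the nodes at depths
-- 0 .. m-1 (the unlabelled 'tip's only mark the end of a branch).

data Tree (m : ℕ) : ℕ → Set where
  tip  : Tree m zero
  node : ∀ {d} → Fin m → Tree m d → Tree m d → Tree m (suc d)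

data PathLabels {m} : ∀ {d} → Tree m d → List (Fin m) → Set where
  tip   : PathLabels tip []
  left  : ∀ {d e} {l r : Tree m d} {ls} → PathLabels l ls → PathLabels (node e l r) (e ∷ ls)
  right : ∀ {d e} {l r : Tree m d} {ls} → PathLabels r ls → PathLabels (node e l r) (e ∷ ls)

open import Data.List.Relation.Binary.Permutation.Propositional using (_↭_)
open import Data.List using (allFin)

IsDecisionTree : ∀ {m} → Graph m → Tree m m → Set
IsDecisionTree {m} G Δ = ∀ ls → PathLabels Δ ls → ls ↭ allFin m

data EdgeType : Set where
  Se L Si I : EdgeType

data Run {m} (S : Fin m → Bool) : Graph m → ∀ {d} → Tree m d → List (Fin m × EdgeType) → Set₁ where
  done  : ∀ {H} → Run S H tip []
  stepSe : ∀ {H d e} {l r : Tree m d} {tr} → IsStandard H e → S e ≡ false →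
           Run S (delete H e) l tr → Run S H (node e l r) ((e , Se) ∷ tr)
  stepL  : ∀ {H d e} {l r : Tree m d} {tr} → IsLoop H e →
           Run S (delete H e) l tr → Run S H (node e l r) ((e , L) ∷ tr)
  stepSi : ∀ {H d e} {l r : Tree m d} {tr} → IsStandard H e → S e ≡ true →
           Run S (contract H e) r tr → Run S H (node e l r) ((e , Si) ∷ tr)
  stepI  : ∀ {H d e} {l r : Tree m d} {tr} → IsIsthmus H e →
           Run S (contract H e) r tr → Run S H (node e l r) ((e , I) ∷ tr)

Active : ∀ {m} → List (Fin m × EdgeType) → Fin m → Set
Active tr e = ((e , L) ∈ tr) ⊎ ((e , I) ∈ tr)

OrdLe : ∀ {m} → List (Fin m × EdgeType) → Fin m → Fin m → Set
OrdLe tr f e = f ≡ e ⊎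
  (∃[ xs ] ∃[ ys ] ∃[ zs ] map proj₁ tr ≡ xs ++ f ∷ ys ++ e ∷ zs)

MaxInFundCycle : ∀ {m} → Graph m → (Fin m → Bool) → List (Fin m × EdgeType) → Fin m → Set
MaxInFundCycle G S tr e =
  ∀ x es vs → Cycle (restrict G (plus S e)) x es vs → ∀ f → f ∈ es → OrdLe tr f e

-- f belongs to the fundamental cocycle of e ∈ T: f has one endpoint in
-- each of the two components of T \ e (those of the two ends of e).
InFundCocycle : ∀ {m} → Graph m → (Fin m → Bool) → Fin m → Fin m → Set
InFundCocycle G S e f =
  (Conn H a u × Conn H b v) ⊎ (Conn H a v × Conn H b u)
  where
  H = restrict G (minus S e)
  u = proj₁ (ends G e)
  v = proj₂ (ends G e)
  a = proj₁ (ends G f)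
  b = proj₂ (ends G f)

MaxInFundCocycle : ∀ {m} → Graph m → (Fin m → Bool) → List (Fin m × EdgeType) → Fin m → Set
MaxInFundCocycle G S tr e = ∀ f → InFundCocycle G S e f → OrdLe tr f e

module Submission where

-- Along the run, the current graph H is the minor of G in which the
-- edges already handled ("done") are contracted if they lie in T and
-- deleted otherwise (the invariant Minor).  For the edge e handled next:
--   * if e ∉ T, e is never an isthmus of H, and it is a loop of H iff every
--     other edge of the cycles of T + e is done;
--   * if e ∈ T, e is never a loop of H, and it is an isthmus of H iff every
--     other edge of its fundamental cocycle is done.
-- As e is active iff it is a loop or an isthmus of H, and the edges done
-- before e are exactly those below e in the (Δ,T)-ordering, this is the
-- proposition.

open import Defs
open import Data.Nat using (ℕ; zero; suc; _<_; z≤n; s≤s)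
open import Data.Fin using (Fin) renaming (zero to fzero; suc to fsuc)
open import Data.Fin.Properties using (0≢1+n)
import Data.Fin as Fin
open import Data.Bool using (Bool; true; false; _∧_; _∨_; not; T)
open import Data.Bool.Properties using (T-∧; T-∨; T-≡; T-not-≡; T-irrelevant)
open import Data.Unit using (tt)
open import Data.Empty using (⊥; ⊥-elim)
open import Data.Product using (Σ; _×_; _,_; proj₁; proj₂; ∃-syntax)
open import Data.Sum using (_⊎_; inj₁; inj₂; [_,_]′)
import Data.Sum as Sum
open import Data.List using (List; []; _∷_; _++_; map; allFin; [_])
open import Data.List.Properties using (map-++; ++-assoc; ∷-injective)
open import Data.List.Membership.Propositional using (_∈_; _∉_)
open import Data.List.Membership.Propositional.Properties
  using (∈-++⁺ˡ; ∈-++⁺ʳ; ∈-++⁻; ∈-∃++; ∈-map⁺; ∈-allFin)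
open import Data.List.Relation.Unary.Any using (here; there)
open import Data.List.Relation.Unary.All.Properties.Core using (¬Any⇒All¬; All¬⇒¬Any)
open import Data.List.Relation.Unary.AllPairs using ([]; _∷_)
open import Data.List.Relation.Unary.Unique.Propositional using (Unique)
open import Data.List.Relation.Unary.Unique.Propositional.Properties using (allFin⁺)
open import Data.List.Relation.Binary.Permutation.Propositional using (_↭_; ↭-sym; ↭⇒↭ₛ)
open import Data.List.Relation.Binary.Permutation.Propositional.Properties using (∈-resp-↭)
open import Function.Base using (_∘_; id)
open import Function.Bundles using (_⇔_; mk⇔; Equivalence)
open import Function.Properties.Equivalence using () renaming (trans to ⇔-trans)
open import Relation.Nullary using (¬_; yes; no)
open import Relation.Nullary.Decidable using (⌊_⌋; toWitness; toWitnessFalse; fromWitness; fromWitnessFalse)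
open import Relation.Binary.PropositionalEquality hiding ([_])

module _ {m : ℕ} {M : Fin m → Bool} {f i : Fin m} where

  ∈minus⁻ : T (minus M f i) → T (M i) × i ≢ f
  ∈minus⁻ t = let (a , b) = Equivalence.to T-∧ t in a , toWitnessFalse b

  ∈minus⁺ : T (M i) → i ≢ f → T (minus M f i)
  ∈minus⁺ a i≢f = Equivalence.from T-∧ (a , fromWitnessFalse i≢f)

  ∈plus⁻ : T (plus M f i) → T (M i) ⊎ i ≡ f
  ∈plus⁻ t = Sum.map₂ toWitness (Equivalence.to T-∨ t)

  ∈plus⁺ : T (M i) ⊎ i ≡ f → T (plus M f i)
  ∈plus⁺ h = Equivalence.from T-∨ (Sum.map₂ fromWitness h)

not-∨ : ∀ a b → not a ∧ not b ≡ not (a ∨ b)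
not-∨ true  _ = refl
not-∨ false _ = refl

unique-cons : ∀ {A : Set} {x : A} {xs} → x ∉ xs → Unique xs → Unique (x ∷ xs)
unique-cons {xs = xs} x∉xs u = ¬Any⇒All¬ xs x∉xs ∷ u

unique-++ʳ : ∀ {A : Set} (xs : List A) {ys} → Unique (xs ++ ys) → Unique ys
unique-++ʳ []       u       = u
unique-++ʳ (_ ∷ xs) (_ ∷ u) = unique-++ʳ xs u

unique-middle : ∀ {A : Set} (xs : List A) {y ys} → Unique (xs ++ y ∷ ys) → y ∉ xs ++ ys
unique-middle []       (y∉ys ∷ _) y∈ys        = All¬⇒¬Any y∉ys y∈ys
unique-middle (x ∷ xs) (x∉ ∷ _)   (here refl) = All¬⇒¬Any x∉ (∈-++⁺ʳ xs (here refl))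
unique-middle (x ∷ xs) (_ ∷ u)    (there y∈)  = unique-middle xs u y∈

unique-resp-↭ : ∀ {A : Set} {xs ys : List A} → xs ↭ ys → Unique xs → Unique ys
unique-resp-↭ {A} xs↭ys = Unique-resp-↭ (↭⇒↭ₛ xs↭ys)
  where
  open import Data.List.Relation.Binary.Permutation.Setoid.Properties (setoid A)
    using (Unique-resp-↭)

before⇔prefix : ∀ {A : Set} (P : List A) {e f : A} {R} → Unique (P ++ e ∷ R) →
  (∃[ xs ] ∃[ ys ] ∃[ zs ] P ++ e ∷ R ≡ xs ++ f ∷ ys ++ e ∷ zs) ⇔ f ∈ P
before⇔prefix P {e} {f} {R} u =
  mk⇔ (λ (xs , _ , _ , eq) → before⇒prefix P xs u eq) prefix⇒before
  where
  before⇒prefix : ∀ P xs {ys zs R} → Unique (P ++ e ∷ R) →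
                  P ++ e ∷ R ≡ xs ++ f ∷ ys ++ e ∷ zs → f ∈ P
  before⇒prefix [] [] {ys} (e∉R ∷ _) eq =
    ⊥-elim (All¬⇒¬Any e∉R (subst (e ∈_) (sym (proj₂ (∷-injective eq))) (∈-++⁺ʳ ys (here refl))))
  before⇒prefix [] (_ ∷ xs) {ys} (e∉R ∷ _) eq =
    ⊥-elim (All¬⇒¬Any e∉R (subst (e ∈_) (sym (proj₂ (∷-injective eq)))
                                 (∈-++⁺ʳ xs (there (∈-++⁺ʳ ys (here refl))))))
  before⇒prefix (_ ∷ P) []       _       eq = here (sym (proj₁ (∷-injective eq)))
  before⇒prefix (_ ∷ P) (_ ∷ xs) (_ ∷ u) eq =
    there (before⇒prefix P xs u (proj₂ (∷-injective eq)))
  prefix⇒before : f ∈ P → ∃[ xs ] ∃[ ys ] ∃[ zs ] P ++ e ∷ R ≡ xs ++ f ∷ ys ++ e ∷ zs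
  prefix⇒before f∈P with ∈-∃++ f∈P
  ... | xs , ys , refl = xs , ys , R , ++-assoc xs (f ∷ ys) (e ∷ R)

value-unique : ∀ {A B : Set} (kvs : List (A × B)) {a : A} {b b′ : B} →
               Unique (map proj₁ kvs) → (a , b) ∈ kvs → (a , b′) ∈ kvs → b ≡ b′
value-unique (_ ∷ kvs) _       (here refl) (here refl) = refl
value-unique (_ ∷ kvs) (a∉ ∷ _) (here refl) (there q)   = ⊥-elim (All¬⇒¬Any a∉ (∈-map⁺ proj₁ q))
value-unique (_ ∷ kvs) (a∉ ∷ _) (there p)   (here refl) = ⊥-elim (All¬⇒¬Any a∉ (∈-map⁺ proj₁ p))
value-unique (_ ∷ kvs) (_ ∷ u)  (there p)   (there q)   = value-unique kvs u p q

module _ {A : Set} where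

  link-sym : ∀ {p : A × A} {x y} → Link p x y → Link p y x
  link-sym = Sum.swap

  link-map : ∀ {B : Set} (f : A → B) {p : A × A} {x y} →
             Link p x y → Link (f (proj₁ p) , f (proj₂ p)) (f x) (f y)
  link-map f (inj₁ (refl , refl)) = inj₁ (refl , refl)
  link-map f (inj₂ (refl , refl)) = inj₂ (refl , refl)

  link-collapse : ∀ {B : Set} (f : A → B) {p : A × A} {x y} →
                  Link p x y → f (proj₁ p) ≡ f (proj₂ p) → f x ≡ f y
  link-collapse f (inj₁ (refl , refl)) q = q
  link-collapse f (inj₂ (refl , refl)) q = sym q

  link-start : ∀ {p : A × A} {x y} → Link p x y → proj₁ p ≡ x ⊎ proj₂ p ≡ x
  link-start (inj₁ (a , _)) = inj₁ a
  link-start (inj₂ (_ , b)) = inj₂ b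

  link-ends : ∀ {p : A × A} {x y c} → Link p x y → proj₁ p ≡ c ⊎ proj₂ p ≡ c → c ≡ x ⊎ c ≡ y
  link-ends (inj₁ (refl , refl)) (inj₁ refl) = inj₁ refl
  link-ends (inj₁ (refl , refl)) (inj₂ refl) = inj₂ refl
  link-ends (inj₂ (refl , refl)) (inj₁ refl) = inj₂ refl
  link-ends (inj₂ (refl , refl)) (inj₂ refl) = inj₁ refl

module Walks {m : ℕ} (H : Graph m) where

  open import Data.List.Membership.DecPropositional (decV H) using (_∈?_)

  _++ʷ_ : ∀ {x y z es es′ vs vs′} → Walk H x y es vs → Walk H y z es′ vs′ →
          Walk H x z (es ++ es′) (vs ++ vs′)
  nil          ++ʷ w′ = w′
  cons i t l w ++ʷ w′ = cons i t l (w ++ʷ w′)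

  conn-refl : ∀ {x} → Conn H x x
  conn-refl = [] , [] , nil

  conn-trans : ∀ {x y z} → Conn H x y → Conn H y z → Conn H x z
  conn-trans (_ , _ , w) (_ , _ , w′) = _ , _ , w ++ʷ w′

  conn-edge : ∀ {x y} i → T (E H i) → Link (ends H i) x y → Conn H x y
  conn-edge i t l = _ , _ , cons i t l nil

  walk-reverse : ∀ {x y es vs} → Walk H x y es vs → Conn H y x
  walk-reverse nil            = conn-refl
  walk-reverse (cons i t l w) = conn-trans (walk-reverse w) (conn-edge i t (link-sym l))

  conn-sym : ∀ {x y} → Conn H x y → Conn H y x
  conn-sym (_ , _ , w) = walk-reverse w

  link-conn : ∀ {p : V H × V H} {x y} → Link p x y → Conn H y x →
              Conn H (proj₂ p) (proj₁ p)
  link-conn (inj₁ (refl , refl)) c = c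
  link-conn (inj₂ (refl , refl)) c = conn-sym c

  walk-edge : ∀ {x z es vs i} → Walk H x z es vs → i ∈ es → T (E H i)
  walk-edge (cons i t l w) (here refl) = t
  walk-edge (cons i t l w) (there p)   = walk-edge w p

  walk-start : ∀ {x z es vs} → Walk H x z es vs → x ∈ vs ⊎ x ≡ z
  walk-start nil            = inj₂ refl
  walk-start (cons _ _ _ _) = inj₁ (here refl)

  walk-edge-ends : ∀ {x z es vs i} → Walk H x z es vs → i ∈ es →
                   ∀ {y w} → Link (ends H i) y w → y ∈ vs ⊎ y ≡ z
  walk-edge-ends (cons i t l w) (here refl) l′ with link-ends l (link-start l′)
  ... | inj₁ refl = inj₁ (here refl)
  ... | inj₂ refl = Sum.map₁ there (walk-start w)
  walk-edge-ends (cons i t l w) (there p) l′ = Sum.map₁ there (walk-edge-ends w p l′)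

  split-at-vertex : ∀ {x z es vs y} → Walk H x z es vs → y ∈ vs →
    ∃[ es₁ ] ∃[ vs₁ ] ∃[ es₂ ] ∃[ vs₂ ]
      (Walk H y z es₂ vs₂ × vs ≡ vs₁ ++ vs₂ × es ≡ es₁ ++ es₂)
  split-at-vertex (cons i t l w) (here refl) = [] , [] , _ , _ , cons i t l w , refl , refl
  split-at-vertex (cons i t l w) (there p) with split-at-vertex w p
  ... | es₁ , vs₁ , _ , _ , w′ , refl , refl = i ∷ es₁ , _ ∷ vs₁ , _ , _ , w′ , refl , refl

  split-at-edge : ∀ {x z es vs f} → Walk H x z es vs → f ∈ es →
    ∃[ y₁ ] ∃[ y₂ ] ∃[ p ] ∃[ q ] ∃[ pv ] ∃[ qv ]
      (Walk H x y₁ p pv × Link (ends H f) y₁ y₂ × Walk H y₂ z q qv × es ≡ p ++ f ∷ q)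
  split-at-edge (cons i t l w) (here refl) = _ , _ , [] , _ , [] , _ , nil , l , w , refl
  split-at-edge (cons i t l w) (there p) with split-at-edge w p
  ... | _ , _ , p′ , _ , _ , _ , w₁ , l′ , w₂ , refl =
    _ , _ , i ∷ p′ , _ , _ ∷ _ , _ , cons i t l w₁ , l′ , w₂ , refl

  shortcut : ∀ {x z es vs} → Walk H x z es vs →
             ∃[ es′ ] ∃[ vs′ ] (Walk H x z es′ vs′ × Unique es′ × Unique vs′ × z ∉ vs′)
  shortcut nil = [] , [] , nil , [] , [] , λ ()
  shortcut {x} {z} (cons i t l w) with shortcut w
  ... | es′ , vs′ , p , ue , uv , z∉vs′ with decV H x z
  ...   | yes refl = [] , [] , nil , [] , [] , λ ()
  ...   | no x≢z with x ∈? vs′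
  ...     | yes x∈vs′ with split-at-vertex p x∈vs′
  ...       | es₁ , vs₁ , _ , _ , p′ , refl , refl =
    _ , _ , p′ , unique-++ʳ es₁ ue , unique-++ʳ vs₁ uv , λ z∈ → z∉vs′ (∈-++⁺ʳ vs₁ z∈)
  shortcut {x} {z} (cons i t l w) | es′ , vs′ , p , ue , uv , z∉vs′ | no x≢z | no x∉vs′ =
    i ∷ es′ , x ∷ vs′ , cons i t l p , unique-cons i∉es′ ue , unique-cons x∉vs′ uv , z∉x∷vs′
    where
    i∉es′ : i ∉ es′
    i∉es′ i∈ = [ x∉vs′ , x≢z ]′ (walk-edge-ends p i∈ l)
    z∉x∷vs′ : z ∉ x ∷ vs′
    z∉x∷vs′ (here z≡x) = x≢z (sym z≡x)
    z∉x∷vs′ (there z∈) = z∉vs′ z∈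

connected-labels-equal : ∀ {m} {H : Graph m} {k} → Connected H → NumComponents H k →
                         (j j′ : Fin k) → j ≡ j′
connected-labels-equal conn (c , fibres , onto) j j′ with onto j | onto j′
... | x , refl | y , refl = proj₂ (fibres x y) (conn x y)

not-isthmus : ∀ {m} {H : Graph m} {e} → V H → Connected (delete H e) → ¬ IsIsthmus H e
not-isthmus z conn (_ , _ , _ , (c , _) , nc′ , k<k′) =
  two-labels (c z) k<k′ (connected-labels-equal conn nc′)
  where
  two-labels : ∀ {k k′} → Fin k → k < k′ → ¬ (∀ (j j′ : Fin k′) → j ≡ j′)
  two-labels {suc _} {suc zero}     _ (s≤s ())
  two-labels {suc _} {suc (suc _)}  _ _ all-equal with all-equal fzero (fsuc fzero)
  ... | ()

module Contraction {m : ℕ} (H : Graph m) (e : Fin m) where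

  p q : V H
  p = proj₁ (ends H e)
  q = proj₂ (ends H e)

  Rest : Set
  Rest = Σ (V H) (λ x → T (not ⌊ decV H x q ⌋))

  rest-≡ : {r s : Rest} → proj₁ r ≡ proj₁ s → r ≡ s
  rest-≡ {x , a} {.x , b} refl = cong (x ,_) (T-irrelevant a b)

  merge : p ≢ q → V H → Rest
  merge p≢q x with decV H x q
  ... | yes _   = p , fromWitnessFalse p≢q
  ... | no x≢q = x , fromWitnessFalse x≢q

  merge-fixes : ∀ p≢q x → x ≢ q → proj₁ (merge p≢q x) ≡ x
  merge-fixes p≢q x x≢q with decV H x q
  ... | yes x≡q = ⊥-elim (x≢q x≡q)
  ... | no _    = refl

  merge-q : ∀ p≢q → proj₁ (merge p≢q q) ≡ p
  merge-q p≢q with decV H q q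
  ... | yes _  = refl
  ... | no q≢q = ⊥-elim (q≢q refl)

  merge-fibres : ∀ p≢q x y → merge p≢q x ≡ merge p≢q y →
                 x ≡ y ⊎ ((x ≡ p ⊎ x ≡ q) × (y ≡ p ⊎ y ≡ q))
  merge-fibres p≢q x y eq with decV H x q | decV H y q
  ... | yes x≡q | yes y≡q = inj₂ (inj₂ x≡q , inj₂ y≡q)
  ... | yes x≡q | no _    = inj₂ (inj₂ x≡q , inj₁ (sym (cong proj₁ eq)))
  ... | no _    | yes y≡q = inj₂ (inj₁ (cong proj₁ eq) , inj₂ y≡q)
  ... | no _    | no _    = inj₁ (cong proj₁ eq)

  collapse : V H → V (contract H e)
  collapse x with decV H p q
  ... | yes _   = x
  ... | no p≢q = merge p≢q x

  lift : V (contract H e) → V H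
  lift r with decV H p q
  ... | yes _ = r
  ... | no _  = proj₁ r

  collapse-lift : ∀ r → collapse (lift r) ≡ r
  collapse-lift r with decV H p q
  ... | yes _   = refl
  ... | no p≢q = rest-≡ (merge-fixes p≢q (proj₁ r) (toWitnessFalse (proj₂ r)))

  collapse-identifies-ends : collapse p ≡ collapse q
  collapse-identifies-ends with decV H p q
  ... | yes p≡q = p≡q
  ... | no p≢q = rest-≡ (trans (merge-fixes p≢q p p≢q) (sym (merge-q p≢q)))

  collapse-fibres : p ≢ q → ∀ x y → collapse x ≡ collapse y →
                    x ≡ y ⊎ ((x ≡ p ⊎ x ≡ q) × (y ≡ p ⊎ y ≡ q))
  collapse-fibres p≢q′ x y with decV H p q
  ... | yes p≡q = ⊥-elim (p≢q′ p≡q)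
  ... | no p≢q = merge-fibres p≢q x y

  contract-edges : ∀ i → E (contract H e) i ≡ minus (E H) e i
  contract-edges i with decV H p q
  ... | yes _ = refl
  ... | no _  = refl

  contract-ends : ∀ i → ends (contract H e) i ≡
                        (collapse (proj₁ (ends H i)) , collapse (proj₂ (ends H i)))
  contract-ends i with decV H p q
  ... | yes _ = refl
  ... | no p≢q with decV H (proj₁ (ends H i)) q | decV H (proj₂ (ends H i)) q
  ...   | yes _ | yes _ = cong₂ _,_ (rest-≡ refl) (rest-≡ refl)
  ...   | yes _ | no _  = cong₂ _,_ (rest-≡ refl) (rest-≡ refl)
  ...   | no _  | yes _ = cong₂ _,_ (rest-≡ refl) (rest-≡ refl)
  ...   | no _  | no _  = cong₂ _,_ (rest-≡ refl) (rest-≡ refl)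

active-type : EdgeType → Bool
active-type L = true
active-type I = true
active-type _ = false

run-labels : ∀ {m} {S : Fin m → Bool} {H d} {Δ : Tree m d} {tr} →
             Run S H Δ tr → PathLabels Δ (map proj₁ tr)
run-labels done            = tip
run-labels (stepSe _ _ r)  = left (run-labels r)
run-labels (stepL _ r)     = left (run-labels r)
run-labels (stepSi _ _ r)  = right (run-labels r)
run-labels (stepI _ r)     = right (run-labels r)

module SpanningTree {n m : ℕ} (en : Fin m → Fin n × Fin n) (S : Fin m → Bool)
  (tree-connected : Connected (restrict (mkGraph en) S))
  (tree-acyclic : ∀ x es vs → ¬ Cycle (restrict (mkGraph en) S) x es vs) where

  G : Graph m
  G = mkGraph en

  R : (Fin m → Bool) → Graph m
  R M = restrict G M

  _⊆_ : (Fin m → Bool) → (Fin m → Bool) → Set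
  M ⊆ M′ = ∀ i → T (M i) → T (M′ i)

  walk-mono-on : ∀ {M M′ x y es vs} → (∀ i → i ∈ es → T (M i) → T (M′ i)) →
                 Walk (R M) x y es vs → Walk (R M′) x y es vs
  walk-mono-on keep nil            = nil
  walk-mono-on keep (cons i t l w) =
    cons i (keep i (here refl) t) l (walk-mono-on (λ j j∈ → keep j (there j∈)) w)

  walk-mono : ∀ {M M′ x y es vs} → M ⊆ M′ → Walk (R M) x y es vs → Walk (R M′) x y es vs
  walk-mono M⊆M′ = walk-mono-on (λ i _ → M⊆M′ i)

  conn-mono : ∀ {M M′ x y} → M ⊆ M′ → Conn (R M) x y → Conn (R M′) x y
  conn-mono M⊆M′ (es , vs , w) = es , vs , walk-mono M⊆M′ w

  close-cycle : ∀ {M M′ f es vs} → M ⊆ M′ → T (M′ f) → ¬ T (M f) →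
    Walk (R M) (proj₂ (en f)) (proj₁ (en f)) es vs →
    ∃[ es′ ] ∃[ vs′ ] (Cycle (R M′) (proj₁ (en f)) (f ∷ es′) (proj₁ (en f) ∷ vs′) ×
                       Walk (R M) (proj₂ (en f)) (proj₁ (en f)) es′ vs′)
  close-cycle {M} {f = f} M⊆M′ f∈M′ f∉M w with Walks.shortcut (R M) w
  ... | es′ , vs′ , p , ue , uv , a∉vs′ =
    es′ , vs′ ,
    (cons f f∈M′ (inj₁ (refl , refl)) (walk-mono M⊆M′ p) , (λ ()) ,
     unique-cons (λ f∈ → f∉M (Walks.walk-edge (R M) p f∈)) ue , unique-cons a∉vs′ uv) ,
    p

  tree-edge-separates : ∀ f → S f ≡ true →
                        ¬ Conn (R (minus S f)) (proj₂ (en f)) (proj₁ (en f))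
  tree-edge-separates f Sf (_ , _ , w)
    with close-cycle {minus S f} {S} (λ i t → proj₁ (∈minus⁻ {M = S} t))
                     (Equivalence.from T-≡ Sf) (λ t → proj₂ (∈minus⁻ {M = S} t) refl) w
  ... | _ , _ , cycle , _ = tree-acyclic _ _ _ cycle

  module TreeEdge (e : Fin m) (e∈T : S e ≡ true) where

    u v : Fin n
    u = proj₁ (en e)
    v = proj₂ (en e)

    K : Graph m
    K = R (minus S e)

    open Walks K

    u≁v : ¬ Conn K u v
    u≁v c = tree-edge-separates e e∈T (conn-sym c)

    Side : Fin n → Set
    Side x = Conn K x u ⊎ Conn K x v

    -- Following a tree walk backwards, a side is kept or e is crossed.
    side-along : ∀ {x z es vs} → Walk (R S) x z es vs → Side z → Side x
    side-along nil s = s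
    side-along (cons i t l w) s with i Fin.≟ e
    ... | yes refl = Sum.map (λ u≡x → subst (λ y → Conn K y u) u≡x conn-refl)
                             (λ v≡x → subst (λ y → Conn K y v) v≡x conn-refl) (link-start l)
    ... | no i≢e = Sum.map (conn-trans (step l)) (conn-trans (step l)) (side-along w s)
      where
      step : ∀ {x y} → Link (en i) x y → Conn K x y
      step = conn-edge i (∈minus⁺ {M = S} t i≢e)

    side : ∀ x → Side x
    side x = side-along (proj₂ (proj₂ (tree-connected x u))) (inj₁ conn-refl)

    label : Fin n → Fin 2
    label x = [ (λ _ → fzero) , (λ _ → fsuc fzero) ]′ (side x)

    label-u : label u ≡ fzero
    label-u with side u
    ... | inj₁ _   = refl
    ... | inj₂ u~v = ⊥-elim (u≁v u~v)

    label-v : label v ≡ fsuc fzero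
    label-v with side v
    ... | inj₁ v~u = ⊥-elim (u≁v (conn-sym v~u))
    ... | inj₂ _   = refl

    conn⇒same-label : ∀ {x y} → Conn K x y → label x ≡ label y
    conn⇒same-label {x} {y} c with side x | side y
    ... | inj₁ _   | inj₁ _   = refl
    ... | inj₂ _   | inj₂ _   = refl
    ... | inj₁ x~u | inj₂ y~v = ⊥-elim (u≁v (conn-trans (conn-sym x~u) (conn-trans c y~v)))
    ... | inj₂ x~v | inj₁ y~u =
      ⊥-elim (u≁v (conn-trans (conn-sym y~u) (conn-trans (conn-sym c) x~v)))

    same-label⇒conn : ∀ {x y} → label x ≡ label y → Conn K x y
    same-label⇒conn {x} {y} eq with side x | side y
    ... | inj₁ x~u | inj₁ y~u = conn-trans x~u (conn-sym y~u)
    ... | inj₂ x~v | inj₂ y~v = conn-trans x~v (conn-sym y~v)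
    ... | inj₁ _   | inj₂ _   = ⊥-elim (0≢1+n eq)
    ... | inj₂ _   | inj₁ _   = ⊥-elim (0≢1+n (sym eq))

    cocycle-or-same-label : ∀ f → InFundCocycle G S e f ⊎
                                  label (proj₁ (en f)) ≡ label (proj₂ (en f))
    cocycle-or-same-label f with side (proj₁ (en f)) | side (proj₂ (en f))
    ... | inj₁ _   | inj₁ _   = inj₂ refl
    ... | inj₂ _   | inj₂ _   = inj₂ refl
    ... | inj₁ a~u | inj₂ b~v = inj₁ (inj₁ (a~u , b~v))
    ... | inj₂ a~v | inj₁ b~u = inj₁ (inj₂ (a~v , b~u))

  push-walk : ∀ {M} (H′ : Graph m) (π : Fin n → V H′) →
    (∀ i → ends H′ i ≡ (π (proj₁ (en i)) , π (proj₂ (en i)))) →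
    (∀ i → T (M i) → T (E H′ i) ⊎ π (proj₁ (en i)) ≡ π (proj₂ (en i))) →
    ∀ {x y es vs} → Walk (R M) x y es vs → Conn H′ (π x) (π y)
  push-walk H′ π ends-π kept nil = Walks.conn-refl H′
  push-walk H′ π ends-π kept {y = y} (cons i t l w) with kept i t
  ... | inj₁ i∈H′ = Walks.conn-trans H′
          (Walks.conn-edge H′ i i∈H′ (subst (λ p → Link p _ _) (sym (ends-π i)) (link-map π l)))
          (push-walk H′ π ends-π kept w)
  ... | inj₂ collapsed = subst (λ z → Conn H′ z (π y)) (sym (link-collapse π l collapsed))
          (push-walk H′ π ends-π kept w)

  reroute : ∀ {M K e} → Conn (R K) (proj₁ (en e)) (proj₂ (en e)) →
    ∀ {x y es vs} → (∀ i → i ∈ es → T (M i) → i ≢ e → T (K i)) →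
    Walk (R M) x y es vs → Conn (R K) x y
  reroute {K = K} c kept nil = Walks.conn-refl (R K)
  reroute {K = K} {e} c kept (cons i t l w) with i Fin.≟ e
  ... | no i≢e = Walks.conn-trans (R K) (Walks.conn-edge (R K) i (kept i (here refl) t i≢e) l)
                                  (reroute c (λ j j∈ → kept j (there j∈)) w)
  ... | yes refl = Walks.conn-trans (R K) (across l) (reroute c (λ j j∈ → kept j (there j∈)) w)
    where
    across : ∀ {x y} → Link (en i) x y → Conn (R K) x y
    across (inj₁ (refl , refl)) = c
    across (inj₂ (refl , refl)) = Walks.conn-sym (R K) c

  -- After the edges in D have been handled,
  -- the current graph H is G with the done tree edges contracted and the
  -- done non-tree edges deleted: vertices of H are the images under a
  -- surjection π of those of G, whose fibres are the components of the
  -- contracted tree edges.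

  contracted : (Fin m → Bool) → Fin m → Bool
  contracted D i = D i ∧ S i

  record Minor (H : Graph m) (D : Fin m → Bool) : Set where
    field
      π          : Fin n → V H
      π⁻¹        : V H → Fin n
      π-π⁻¹      : ∀ z → π (π⁻¹ z) ≡ z
      ends-π     : ∀ i → ends H i ≡ (π (proj₁ (en i)) , π (proj₂ (en i)))
      edges      : ∀ i → E H i ≡ not (D i)
      fibres     : ∀ x y → π x ≡ π y → Conn (R (contracted D)) x y
      collapsed  : ∀ i → T (D i) → S i ≡ true → π (proj₁ (en i)) ≡ π (proj₂ (en i))

  minor-start : Minor G (λ _ → false)
  minor-start = record
    { π = λ x → x ; π⁻¹ = λ x → x ; π-π⁻¹ = λ _ → refl ; ends-π = λ _ → refl
    ; edges = λ _ → refl ; fibres = λ { x .x refl → Walks.conn-refl (R _) }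
    ; collapsed = λ _ () }

  -- e is maximal in the cycles of T + e (resp. in its cocycle) once every
  -- other edge there is done; the ordering makes this the paper's notion.
  OthersDoneInCycles : (Fin m → Bool) → Fin m → Set
  OthersDoneInCycles D e =
    ∀ x es vs → Cycle (R (plus S e)) x es vs → ∀ f → f ∈ es → f ≡ e ⊎ T (D f)

  OthersDoneInCocycle : (Fin m → Bool) → Fin m → Set
  OthersDoneInCocycle D e = ∀ f → InFundCocycle G S e f → f ≡ e ⊎ T (D f)

  -- The statement of the theorem for e of type t, with "≤ e in the
  -- ordering" read as "equal to e or done before e".
  ActiveIffMaximal : (Fin m → Bool) → Fin m → EdgeType → Set
  ActiveIffMaximal D e t =
    (S e ≡ false → T (active-type t) ⇔ OthersDoneInCycles D e) ×
    (S e ≡ true  → T (active-type t) ⇔ OthersDoneInCocycle D e)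

  module Current {H : Graph m} {D : Fin m → Bool} (minor : Minor H D)
                 (e : Fin m) (e∈H : T (E H e)) where
    open Minor minor

    u v : Fin n
    u = proj₁ (en e)
    v = proj₂ (en e)

    undone⇒present : ∀ {i} → D i ≡ false → T (E H i)
    undone⇒present {i} Dᵢ≡false rewrite edges i | Dᵢ≡false = tt

    present⇒undone : ∀ {i} → T (E H i) → D i ≡ false
    present⇒undone {i} i∈H = Equivalence.to T-not-≡ (subst T (edges i) i∈H)

    e-undone : D e ≡ false
    e-undone = present⇒undone e∈H

    contracted⊆T∖e : contracted D ⊆ minus S e
    contracted⊆T∖e i t with Equivalence.to (T-∧ {D i}) t
    ... | Dᵢ , Sᵢ = ∈minus⁺ {M = S} Sᵢ λ { refl → subst T e-undone Dᵢ }

    contracted-walk : ∀ {x y es vs} → Walk (R (contracted D)) x y es vs → π x ≡ π y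
    contracted-walk nil = refl
    contracted-walk (cons i t l w) with Equivalence.to (T-∧ {D i}) t
    ... | Dᵢ , Sᵢ =
      trans (link-collapse π l (collapsed i Dᵢ (Equivalence.to T-≡ Sᵢ))) (contracted-walk w)

    tree-edge-kept : ∀ i → T (S i) → T (E H i) ⊎ π (proj₁ (en i)) ≡ π (proj₂ (en i))
    tree-edge-kept i Sᵢ with D i in Dᵢ≡
    ... | true  = inj₂ (collapsed i (subst T (sym Dᵢ≡) tt) (Equivalence.to T-≡ Sᵢ))
    ... | false = inj₁ (undone⇒present Dᵢ≡)

    tree-edge-kept∖e : ∀ i → T (minus S e i) →
                       T (minus (E H) e i) ⊎ π (proj₁ (en i)) ≡ π (proj₂ (en i))
    tree-edge-kept∖e i t with ∈minus⁻ {M = S} t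
    ... | Sᵢ , i≢e = Sum.map₁ (λ i∈H → ∈minus⁺ {M = E H} i∈H i≢e) (tree-edge-kept i Sᵢ)

    connected-if-tree-kept : (M : Fin m → Bool) →
      (∀ i → T (S i) → T (M i) ⊎ π (proj₁ (en i)) ≡ π (proj₂ (en i))) →
      Connected (record H { E = M })
    connected-if-tree-kept M kept z w =
      subst₂ (Conn H′) (π-π⁻¹ z) (π-π⁻¹ w)
        (push-walk H′ π ends-π kept (proj₂ (proj₂ (tree-connected (π⁻¹ z) (π⁻¹ w)))))
      where H′ = record H { E = M }

    loop⇒ends-identified : IsLoop H e → π u ≡ π v
    loop⇒ends-identified (_ , p≡q) =
      trans (sym (cong proj₁ (ends-π e))) (trans p≡q (cong proj₂ (ends-π e)))

    -- A non-tree edge is never an isthmus: the tree survives its deletion.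
    nontree-not-isthmus : S e ≡ false → ¬ IsIsthmus H e
    nontree-not-isthmus e∉T = not-isthmus (π u) (connected-if-tree-kept (minus (E H) e) kept)
      where
      kept : ∀ i → T (S i) → T (minus (E H) e i) ⊎ π (proj₁ (en i)) ≡ π (proj₂ (en i))
      kept i Sᵢ = tree-edge-kept∖e i (∈minus⁺ {M = S} Sᵢ λ { refl → subst T e∉T Sᵢ })

    -- A tree edge is never a loop: its ends are not joined in T \ e.
    tree-not-loop : S e ≡ true → ¬ IsLoop H e
    tree-not-loop e∈T lp =
      tree-edge-separates e e∈T
        (Walks.conn-sym (R _) (conn-mono contracted⊆T∖e (fibres u v (loop⇒ends-identified lp))))

    -- If e is a loop, its ends are joined by contracted edges; an undone tree
    -- edge f on a cycle of T + e could then be bypassed in T \ f.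
    loop⇒others-done : S e ≡ false → IsLoop H e → OthersDoneInCycles D e
    loop⇒others-done e∉T lp x es vs (w , _ , ue , _) f f∈es with f Fin.≟ e | D f in Dƒ≡
    ... | yes f≡e | _    = inj₁ f≡e
    ... | no _    | true = inj₂ tt
    ... | no f≢e  | false with Walks.split-at-edge (R (plus S e)) w f∈es
    ...   | y₁ , y₂ , p , q , _ , _ , w₁ , l , w₂ , refl =
      ⊥-elim (tree-edge-separates f f∈T (Walks.link-conn (R (minus S f)) l bypass))
      where
      f∈T : S f ≡ true
      f∈T = Equivalence.to T-≡ ([ id , (λ f≡e → ⊥-elim (f≢e f≡e)) ]′ (∈plus⁻ {M = S} f∈T+e))
        where
        f∈T+e : T (plus S e f)
        f∈T+e = Walks.walk-edge (R (plus S e)) w (∈-++⁺ʳ p (here refl))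
      u~v : Conn (R (minus S f)) u v
      u~v = conn-mono (λ i t → let (Dᵢ , Sᵢ) = Equivalence.to (T-∧ {D i}) t in
                         ∈minus⁺ {M = S} Sᵢ λ { refl → subst T Dƒ≡ Dᵢ })
                      (fibres u v (loop⇒ends-identified lp))
      others≢f : ∀ i → i ∈ q ++ p → T (plus S e i) → i ≢ e → T (minus S f i)
      others≢f i i∈ t i≢e =
        ∈minus⁺ {M = S} ([ id , (λ i≡e → ⊥-elim (i≢e i≡e)) ]′ (∈plus⁻ {M = S} t))
          λ { refl → unique-middle p ue ([ ∈-++⁺ʳ p , ∈-++⁺ˡ ]′ (∈-++⁻ q i∈)) }
      bypass : Conn (R (minus S f)) y₂ y₁
      bypass = reroute u~v others≢f (Walks._++ʷ_ (R (plus S e)) w₂ w₁)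

    -- Conversely the fundamental cycle, closed by e from the tree path from v
    -- to u, has all its tree edges done, hence contracted: π v ≡ π u.
    others-done⇒loop : S e ≡ false → OthersDoneInCycles D e → IsLoop H e
    others-done⇒loop e∉T all-done
      with close-cycle {M = S} {M′ = plus S e} {f = e} (λ i → ∈plus⁺ {M = S} ∘ inj₁)
                       (∈plus⁺ {M = S} (inj₂ refl)) (λ Sₑ → subst T e∉T Sₑ)
                       (proj₂ (proj₂ (tree-connected v u)))
    ... | es′ , _ , cycle , path = e∈H , ends-equal
      where
      path-contracted : ∀ i → i ∈ es′ → T (S i) → T (contracted D i)
      path-contracted i i∈ Sᵢ with all-done _ _ _ cycle i (there i∈)
      ... | inj₁ refl = ⊥-elim (subst T e∉T Sᵢ)
      ... | inj₂ Dᵢ   = Equivalence.from T-∧ (Dᵢ , Sᵢ)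
      ends-equal : proj₁ (ends H e) ≡ proj₂ (ends H e)
      ends-equal = begin
        proj₁ (ends H e) ≡⟨ cong proj₁ (ends-π e) ⟩
        π u              ≡⟨ sym (contracted-walk (walk-mono-on path-contracted path)) ⟩
        π v              ≡⟨ sym (cong proj₂ (ends-π e)) ⟩
        proj₂ (ends H e) ∎
        where open ≡-Reasoning

    module _ (e∈T : S e ≡ true) where
      open TreeEdge e e∈T using (side; label; label-u; label-v;
        conn⇒same-label; same-label⇒conn; cocycle-or-same-label)

      H∖e : Graph m
      H∖e = delete H e

      open Walks H∖e

      push-T∖e : ∀ {x y} → Conn (R (minus S e)) x y → Conn H∖e (π x) (π y)
      push-T∖e (_ , _ , w) = push-walk H∖e π ends-π tree-edge-kept∖e w

      -- An undone cocycle edge f ≠ e would reconnect the two sides in H \ e.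
      isthmus⇒others-done : IsIsthmus H e → OthersDoneInCocycle D e
      isthmus⇒others-done isthmus f f∈C with f Fin.≟ e | D f in Dƒ≡
      ... | yes f≡e | _     = inj₁ f≡e
      ... | no _    | true  = inj₂ tt
      ... | no f≢e  | false = ⊥-elim (not-isthmus (π u) connected isthmus)
        where
        a b : Fin n
        a = proj₁ (en f)
        b = proj₂ (en f)
        a~b : Conn H∖e (π a) (π b)
        a~b = conn-edge f (∈minus⁺ {M = E H} (undone⇒present Dƒ≡) f≢e)
                (subst (λ p → Link p (π a) (π b)) (sym (ends-π f)) (inj₁ (refl , refl)))
        crossing : InFundCocycle G S e f → Conn H∖e (π v) (π u)
        crossing (inj₁ (a~u , b~v)) =
          conn-trans (conn-sym (push-T∖e b~v)) (conn-trans (conn-sym a~b) (push-T∖e a~u))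
        crossing (inj₂ (a~v , b~u)) =
          conn-trans (conn-sym (push-T∖e a~v)) (conn-trans a~b (push-T∖e b~u))
        to-u : ∀ x → Conn H∖e (π x) (π u)
        to-u x = [ push-T∖e , (λ x~v → conn-trans (push-T∖e x~v) (crossing f∈C)) ]′ (side x)
        connected : Connected H∖e
        connected z w = subst₂ (Conn H∖e) (π-π⁻¹ z) (π-π⁻¹ w)
                          (conn-trans (to-u (π⁻¹ z)) (conn-sym (to-u (π⁻¹ w))))

      -- If the cocycle of e is done, the sides of e give exactly two
      -- components of H \ e, while H is connected.
      module _ (all-done : OthersDoneInCocycle D e) where

        component : V H∖e → Fin 2
        component z = label (π⁻¹ z)

        component-π : ∀ x → component (π x) ≡ label x
        component-π x =
          conn⇒same-label (conn-mono contracted⊆T∖e (fibres (π⁻¹ (π x)) x (π-π⁻¹ (π x))))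

        edge-same-component : ∀ i → T (E H∖e i) →
                              component (π (proj₁ (en i))) ≡ component (π (proj₂ (en i)))
        edge-same-component i t with ∈minus⁻ {M = E H} t
        ... | i∈H , i≢e = trans (component-π _) (trans same-side (sym (component-π _)))
          where
          same-side : label (proj₁ (en i)) ≡ label (proj₂ (en i))
          same-side with S i in Sᵢ≡ | cocycle-or-same-label i
          ... | _     | inj₂ same = same
          ... | true  | inj₁ _   = conn⇒same-label
              (Walks.conn-edge (R (minus S e)) i (∈minus⁺ {M = S} (subst T (sym Sᵢ≡) tt) i≢e)
                               (inj₁ (refl , refl)))
          ... | false | inj₁ i∈C with all-done i i∈C
          ...   | inj₁ i≡e = ⊥-elim (i≢e i≡e)
          ...   | inj₂ Dᵢ  = ⊥-elim (subst T (present⇒undone i∈H) Dᵢ)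

        walk-same-component : ∀ {z w es vs} → Walk H∖e z w es vs → component z ≡ component w
        walk-same-component nil = refl
        walk-same-component (cons i t l w) =
          trans (link-collapse component (subst (λ p → Link p _ _) (ends-π i) l)
                                         (edge-same-component i t))
                (walk-same-component w)

        two-components : NumComponents H∖e 2
        two-components =
          component ,
          (λ z w → (λ same → subst₂ (Conn H∖e) (π-π⁻¹ z) (π-π⁻¹ w)
                                      (push-T∖e (same-label⇒conn same))) ,
                   (λ { (_ , _ , walk) → walk-same-component walk })) ,
          λ { fzero → π u , trans (component-π u) label-u
            ; (fsuc fzero) → π v , trans (component-π v) label-v }

        one-component : NumComponents H 1
        one-component =
          (λ _ → fzero) ,
          (λ x y → (λ _ → connected-if-tree-kept (E H) tree-edge-kept x y) , (λ _ → refl)) ,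
          λ { fzero → π u , refl }

        others-done⇒isthmus : IsIsthmus H e
        others-done⇒isthmus = e∈H , 1 , 2 , one-component , two-components , s≤s (s≤s z≤n)

    edges-after : ∀ i → minus (E H) e i ≡ not (plus D e i)
    edges-after i = trans (cong (_∧ not ⌊ i Fin.≟ e ⌋) (edges i)) (not-∨ (D i) _)

    contracted-grows : contracted D ⊆ contracted (plus D e)
    contracted-grows i t with Equivalence.to (T-∧ {D i}) t
    ... | Dᵢ , Sᵢ = Equivalence.from T-∧ (∈plus⁺ {M = D} (inj₁ Dᵢ) , Sᵢ)

    minor-delete : S e ≡ false → Minor (delete H e) (plus D e)
    minor-delete e∉T = record
      { π = π ; π⁻¹ = π⁻¹ ; π-π⁻¹ = π-π⁻¹ ; ends-π = ends-π ; edges = edges-after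
      ; fibres = λ x y πx≡πy → conn-mono contracted-grows (fibres x y πx≡πy)
      ; collapsed = collapsed′ }
      where
      collapsed′ : ∀ i → T (plus D e i) → S i ≡ true → π (proj₁ (en i)) ≡ π (proj₂ (en i))
      collapsed′ i t i∈T with ∈plus⁻ {M = D} t
      ... | inj₁ Dᵢ   = collapsed i Dᵢ i∈T
      ... | inj₂ refl = ⊥-elim (subst T e∉T (Equivalence.from T-≡ i∈T))

    minor-contract : S e ≡ true → ¬ IsLoop H e → Minor (contract H e) (plus D e)
    minor-contract e∈T not-loop = record
      { π = collapse ∘ π
      ; π⁻¹ = π⁻¹ ∘ lift
      ; π-π⁻¹ = λ r → trans (cong collapse (π-π⁻¹ (lift r))) (collapse-lift r)
      ; ends-π = λ i → trans (contract-ends i)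
                             (cong (λ p → collapse (proj₁ p) , collapse (proj₂ p)) (ends-π i))
      ; edges = λ i → trans (contract-edges i) (edges-after i)
      ; fibres = fibres′
      ; collapsed = collapsed′ }
      where
      open Contraction H e
      p≡πu : p ≡ π u
      p≡πu = cong proj₁ (ends-π e)
      q≡πv : q ≡ π v
      q≡πv = cong proj₂ (ends-π e)
      C′ : Graph m
      C′ = R (contracted (plus D e))
      e-contracted : T (contracted (plus D e) e)
      e-contracted = Equivalence.from T-∧ (∈plus⁺ {M = D} (inj₂ refl) , Equivalence.from T-≡ e∈T)
      to-u : ∀ z → π z ≡ p ⊎ π z ≡ q → Conn C′ z u
      to-u z (inj₁ πz≡p) = conn-mono contracted-grows (fibres z u (trans πz≡p p≡πu))
      to-u z (inj₂ πz≡q) =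
        Walks.conn-trans C′ (conn-mono contracted-grows (fibres z v (trans πz≡q q≡πv)))
                            (Walks.conn-edge C′ e e-contracted (inj₂ (refl , refl)))
      fibres′ : ∀ x y → collapse (π x) ≡ collapse (π y) → Conn C′ x y
      fibres′ x y eq with collapse-fibres (λ p≡q → not-loop (e∈H , p≡q)) (π x) (π y) eq
      ... | inj₁ πx≡πy           = conn-mono contracted-grows (fibres x y πx≡πy)
      ... | inj₂ (x-end , y-end) =
        Walks.conn-trans C′ (to-u x x-end) (Walks.conn-sym C′ (to-u y y-end))
      collapsed′ : ∀ i → T (plus D e i) → S i ≡ true →
                   collapse (π (proj₁ (en i))) ≡ collapse (π (proj₂ (en i)))
      collapsed′ i t i∈T with ∈plus⁻ {M = D} t
      ... | inj₁ Dᵢ   = cong collapse (collapsed i Dᵢ i∈T)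
      ... | inj₂ refl =
        subst₂ (λ a b → collapse a ≡ collapse b) p≡πu q≡πv collapse-identifies-ends

    tree-and-nontree : S e ≡ true → S e ≡ false → ⊥
    tree-and-nontree e∈T e∉T with trans (sym e∈T) e∉T
    ... | ()

    standard-deleted : IsStandard H e → S e ≡ false → ActiveIffMaximal D e Se
    standard-deleted (_ , not-loop , _) e∉T =
      (λ _ → mk⇔ (λ ()) (λ all-done → not-loop (others-done⇒loop e∉T all-done))) ,
      (λ e∈T → ⊥-elim (tree-and-nontree e∈T e∉T))

    standard-contracted : IsStandard H e → S e ≡ true → ActiveIffMaximal D e Si
    standard-contracted (_ , _ , not-isthmus-e) e∈T =
      (λ e∉T → ⊥-elim (tree-and-nontree e∈T e∉T)) ,
      (λ _ → mk⇔ (λ ()) (λ all-done → not-isthmus-e (others-done⇒isthmus e∈T all-done)))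

    loop-step : IsLoop H e → ActiveIffMaximal D e L
    loop-step lp =
      (λ e∉T → mk⇔ (λ _ → loop⇒others-done e∉T lp) (λ _ → tt)) ,
      (λ e∈T → ⊥-elim (tree-not-loop e∈T lp))

    isthmus-step : IsIsthmus H e → ActiveIffMaximal D e I
    isthmus-step isthmus =
      (λ e∉T → ⊥-elim (nontree-not-isthmus e∉T isthmus)) ,
      (λ e∈T → mk⇔ (λ _ → isthmus⇒others-done e∈T isthmus) (λ _ → tt))

    loop⇒nontree : IsLoop H e → S e ≡ false
    loop⇒nontree lp with S e in Sₑ≡
    ... | false = refl
    ... | true  = ⊥-elim (tree-not-loop Sₑ≡ lp)

    isthmus⇒tree : IsIsthmus H e → S e ≡ true
    isthmus⇒tree isthmus with S e in Sₑ≡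
    ... | true  = refl
    ... | false = ⊥-elim (nontree-not-isthmus Sₑ≡ isthmus)

  module Trace (tr : List (Fin m × EdgeType)) (distinct : Unique (map proj₁ tr)) where

    Good : Fin m → Set
    Good e = (S e ≡ false → (Active tr e ⇔ MaxInFundCycle G S tr e)) ×
             (S e ≡ true  → (Active tr e ⇔ MaxInFundCocycle G S tr e))

    Records : (Fin m → Bool) → List (Fin m × EdgeType) → Set
    Records D pre = ∀ i → T (D i) ⇔ i ∈ map proj₁ pre

    module Position {D pre} (records : Records D pre) {e t rest}
                    (split : tr ≡ pre ++ (e , t) ∷ rest) where

      keys : map proj₁ tr ≡ map proj₁ pre ++ e ∷ map proj₁ rest
      keys = trans (cong (map proj₁) split) (map-++ proj₁ pre ((e , t) ∷ rest))

      ordered⇔done : ∀ f → OrdLe tr f e ⇔ (f ≡ e ⊎ T (D f))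
      ordered⇔done f = mk⇔
        (Sum.map₂ λ before →
          Equivalence.from (records f) (Equivalence.to prefix (subst (Before f) keys before)))
        (Sum.map₂ λ D-f →
          subst (Before f) (sym keys) (Equivalence.from prefix (Equivalence.to (records f) D-f)))
        where
        Before : Fin m → List (Fin m) → Set
        Before f ks = ∃[ xs ] ∃[ ys ] ∃[ zs ] ks ≡ xs ++ f ∷ ys ++ e ∷ zs
        prefix : ∀ {f} → Before f (map proj₁ pre ++ e ∷ map proj₁ rest) ⇔ f ∈ map proj₁ pre
        prefix = before⇔prefix (map proj₁ pre) (subst Unique keys distinct)

      at-e : (e , t) ∈ tr
      at-e = subst ((e , t) ∈_) (sym split) (∈-++⁺ʳ pre (here refl))

      active⇔ : Active tr e ⇔ T (active-type t)
      active⇔ = mk⇔ [ (λ at → type-active at tt) , (λ at → type-active at tt) ]′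
                    (active-type⇒ t at-e)
        where
        type-active : ∀ {t′} → (e , t′) ∈ tr → T (active-type t′) → T (active-type t)
        type-active at = subst (T ∘ active-type) (value-unique tr distinct at at-e)
        active-type⇒ : ∀ t′ → (e , t′) ∈ tr → T (active-type t′) → Active tr e
        active-type⇒ L at _ = inj₁ at
        active-type⇒ I at _ = inj₂ at

      cycles⇔ : OthersDoneInCycles D e ⇔ MaxInFundCycle G S tr e
      cycles⇔ = mk⇔ (λ h x es vs c f f∈ → Equivalence.from (ordered⇔done f) (h x es vs c f f∈))
                    (λ h x es vs c f f∈ → Equivalence.to (ordered⇔done f) (h x es vs c f f∈))

      cocycle⇔ : OthersDoneInCocycle D e ⇔ MaxInFundCocycle G S tr e
      cocycle⇔ = mk⇔ (λ h f c → Equivalence.from (ordered⇔done f) (h f c))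
                     (λ h f c → Equivalence.to (ordered⇔done f) (h f c))

      good : ActiveIffMaximal D e t → Good e
      good (cycles , cocycle) =
        (λ e∉T → ⇔-trans active⇔ (⇔-trans (cycles e∉T) cycles⇔)) ,
        (λ e∈T → ⇔-trans active⇔ (⇔-trans (cocycle e∈T) cocycle⇔))

      records-next : Records (plus D e) (pre ++ [ (e , t) ])
      records-next i rewrite map-++ proj₁ pre [ (e , t) ] = mk⇔
        (λ D+e-i → [ (λ D-i → ∈-++⁺ˡ (Equivalence.to (records i) D-i)) ,
                     (λ { refl → ∈-++⁺ʳ (map proj₁ pre) (here refl) }) ]′ (∈plus⁻ {M = D} D+e-i))
        (λ i∈ → ∈plus⁺ {M = D} ([ (λ i∈pre → inj₁ (Equivalence.from (records i) i∈pre)) ,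
                                   (λ { (here i≡e) → inj₂ i≡e }) ]′ (∈-++⁻ (map proj₁ pre) i∈)))

      split-next : tr ≡ (pre ++ [ (e , t) ]) ++ rest
      split-next = trans split (sym (++-assoc pre [ (e , t) ] rest))

      handled : ActiveIffMaximal D e t →
        (Records (plus D e) (pre ++ [ (e , t) ]) → tr ≡ (pre ++ [ (e , t) ]) ++ rest →
         ∀ f → f ∈ map proj₁ rest → Good f) →
        ∀ f → f ∈ e ∷ map proj₁ rest → Good f
      handled here-good _    _ (here refl) = good here-good
      handled _         rest-good f (there f∈) = rest-good records-next split-next f f∈

    along-run : ∀ {d H D pre rest} {Δ : Tree m d} → Run S H Δ rest → Minor H D →
      Records D pre → tr ≡ pre ++ rest → ∀ f → f ∈ map proj₁ rest → Good f
    along-run done _ _ _ _ ()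
    along-run (stepSe {e = e} std e∉T r) minor records split =
      Position.handled records split (standard-deleted std e∉T) (along-run r (minor-delete e∉T))
      where open Current minor e (proj₁ std)
    along-run (stepL {e = e} lp r) minor records split =
      Position.handled records split (loop-step lp) (along-run r (minor-delete (loop⇒nontree lp)))
      where open Current minor e (proj₁ lp)
    along-run (stepSi {e = e} std e∈T r) minor records split =
      Position.handled records split (standard-contracted std e∈T)
        (along-run r (minor-contract e∈T (proj₁ (proj₂ std))))
      where open Current minor e (proj₁ std)
    along-run (stepI {e = e} isthmus r) minor records split =
      Position.handled records split (isthmus-step isthmus)
        (along-run r (minor-contract e∈T (tree-not-loop e∈T)))
      where
      open Current minor e (proj₁ isthmus)
      e∈T : S e ≡ true
      e∈T = isthmus⇒tree isthmus

    every-edge-good : ∀ {d} {Δ : Tree m d} → Run S G Δ tr → ∀ e → e ∈ map proj₁ tr → Good e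
    every-edge-good r = along-run r minor-start (λ _ → mk⇔ (λ ()) (λ ())) refl

proposition5p1 : ∀ {n m′} (en : Fin (suc m′) → Fin n × Fin n) →
  Connected (mkGraph en) →
  (Δ : Tree (suc m′) (suc m′)) → IsDecisionTree (mkGraph en) Δ →
  (S : Fin (suc m′) → Bool) → IsSpanningTree (mkGraph en) S →
  (tr : List (Fin (suc m′) × EdgeType)) → Run S (mkGraph en) Δ tr →
  (e : Fin (suc m′)) →
  (S e ≡ false → (Active tr e ⇔ MaxInFundCycle (mkGraph en) S tr e)) ×
  (S e ≡ true → (Active tr e ⇔ MaxInFundCocycle (mkGraph en) S tr e))
proposition5p1 {m′ = m′} en _ _ decision-tree S (tree-connected , tree-acyclic) tr run e =
  Trace.every-edge-good tr distinct run e e∈tr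
  where
  open SpanningTree en S tree-connected tree-acyclic
  -- The run follows a root-to-leaf path of Δ, so it meets every edge once.
  labels : map proj₁ tr ↭ allFin (suc m′)
  labels = decision-tree _ (run-labels run)
  distinct : Unique (map proj₁ tr)
  distinct = unique-resp-↭ (↭-sym labels) (allFin⁺ (suc m′))
  e∈tr : e ∈ map proj₁ tr
  e∈tr = ∈-resp-↭ (↭-sym labels) (∈-allFin e)
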